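{- Let $G$ be an undirected unweighted graph with source $s$, let $\textsc{Spt}(s)$ be its shortest path tree, and let $r$ be a vertex splitting $\textsc{Spt}(s)$ into edge-disjoint subtrees $M$ (containing $s$) and $N$ (rooted at $r$) with $E_M\cup E_N=E_{\textsc{Spt}(s)}$ and $V_M\cap V_N=\{r\}$. Let $G_M,G_N$ be the subgraphs induced by $V_M,V_N$, and let $\mathcal{P}$ be the $s$–$r$ path in $\textsc{Spt}(s)$. Let $e\in\mathcal{P}$ and $t\in G_M$, and assume that the replacement path $R=st\diamond e$ is jumping and uses some edges of $G_N$. Then $|st\diamond e|=|sr\diamond e|+|rt|$, where $|rt|$ is the distance from $r$ to $t$ in $G$.
   Context: The replacement path $xy\diamond e$ (for $e$ on the $x$–$y$ tree path) is the path from $x$ to $y$ avoiding $e$ which (1) diverges from and merges back to the tree path just once, (2) has its divergence point as close to $x$ as possible, and (3) is the lexicographically smallest shortest path satisfying (1),(2); in particular $|xy\diamond e|$ is the distance from $x$ to $y$ in $G\setminus\{e\}$. For $e\in\mathcal{P}$, $st\diamond e$ is jumping if it uses some vertex of $\mathcal{P}$ lying after $e$ on $\mathcal{P}$ (farther from $s$). -}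

module Defs where

open import Data.Nat using (ℕ; zero; suc; _≤_; _+_; _∸_)
open import Data.Fin using (Fin) renaming (_<_ to _<ᶠ_)
open import Data.Bool using (Bool; true; false; T)
open import Data.List using (List; []; _∷_; _++_; length)
open import Data.List.Membership.Propositional using (_∈_; _∉_)
open import Data.List.Relation.Unary.All using (All)
open import Data.List.Relation.Unary.Unique.Propositional using (Unique)
open import Data.Product using (Σ; ∃; ∃₂; _×_; _,_)
open import Data.Sum using (_⊎_)
open import Relation.Binary.PropositionalEquality using (_≡_; _≢_)
open import Relation.Nullary using (¬_)

record Graph (n : ℕ) : Set where
  field
    adj    : Fin n → Fin n → Bool
    sym    : ∀ u v → adj u v ≡ adj v u
    irrefl : ∀ u → adj u u ≡ false

  Adj : Fin n → Fin n → Set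
  Adj u v = T (adj u v)

data Walk {n : ℕ} (A : Fin n → Fin n → Set) : Fin n → Fin n → List (Fin n) → Set where
  [_]ʷ : ∀ x → Walk A x x (x ∷ [])
  _∷ʷ_ : ∀ {x z y p} → A x z → Walk A z y p → Walk A x y (x ∷ p)

Path : {n : ℕ} → (Fin n → Fin n → Set) → Fin n → Fin n → List (Fin n) → Set
Path A x y p = Walk A x y p × Unique p

len : {n : ℕ} → List (Fin n) → ℕ
len p = length p ∸ 1

IsDist : {n : ℕ} → (Fin n → Fin n → Set) → Fin n → Fin n → ℕ → Set
IsDist A x y d =
  (∃ λ p → Path A x y p × len p ≡ d) × (∀ p → Path A x y p → d ≤ len p)

-- Shortest path tree Spt(s): a parent function with BFS depths.
-- Tree edges are {parent c , c} for c ≢ s; an edge is named by its child c.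

record SPT {n : ℕ} (G : Graph n) (s : Fin n) : Set where
  field
    parent    : Fin n → Fin n
    depth     : Fin n → ℕ
    par-adj   : ∀ v → v ≢ s → Graph.Adj G (parent v) v
    depth-par : ∀ v → v ≢ s → depth v ≡ suc (depth (parent v))
    depth-s   : depth s ≡ 0
    depth-dst : ∀ v → IsDist (Graph.Adj G) s v (depth v)

module _ {n : ℕ} {G : Graph n} {s : Fin n} (Tr : SPT G s) where
  open SPT Tr

  data TreePath : Fin n → List (Fin n) → Set where
    root : TreePath s (s ∷ [])
    step : ∀ {v p} → v ≢ s → TreePath (parent v) p → TreePath v (p ++ v ∷ [])

  Anc : Fin n → Fin n → Set
  Anc a v = ∃ λ p → TreePath v p × a ∈ p

  SameEdge : Fin n → Fin n → Fin n → Set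
  SameEdge c u v = (u ≡ parent c × v ≡ c) ⊎ (u ≡ c × v ≡ parent c)

  -- adjacency of G ∖ {e}, e the tree edge with child c
  AdjMinus : Fin n → Fin n → Fin n → Set
  AdjMinus c u v = Graph.Adj G u v × ¬ SameEdge c u v

  TAdj : (Fin n → Set) → Fin n → Fin n → Set
  TAdj ES u v = (ES v × v ≢ s × u ≡ parent v) ⊎ (ES u × u ≢ s × v ≡ parent u)

  record Subtree : Set₁ where
    field
      VS      : Fin n → Set
      ES      : Fin n → Set
      es-tree : ∀ c → ES c → c ≢ s
      es-ends : ∀ c → ES c → VS c × VS (parent c)
      conn    : ∀ x y → VS x → VS y → ∃ λ p → Walk (TAdj ES) x y p

  record Split : Set₁ where
    field
      r        : Fin n
      M        : Subtree
      N        : Subtree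
      s∈M      : Subtree.VS M s
      r∈N      : Subtree.VS N r
      N-rooted : ∀ v → Subtree.VS N v → Anc r v
      disjE    : ∀ c → ¬ (Subtree.ES M c × Subtree.ES N c)
      unionE   : ∀ c → c ≢ s → Subtree.ES M c ⊎ Subtree.ES N c
      interV   : ∀ v → (Subtree.VS M v × Subtree.VS N v → v ≡ r)
                       × (v ≡ r → Subtree.VS M v × Subtree.VS N v)

  data LexLeq : List (Fin n) → List (Fin n) → Set where
    nil  : ∀ {ys} → LexLeq [] ys
    here : ∀ {x y xs ys} → x <ᶠ y → LexLeq (x ∷ xs) (y ∷ ys)
    next : ∀ {x xs ys} → LexLeq xs ys → LexLeq (x ∷ xs) (x ∷ ys)

  -- R diverges from the tree path P just once and merges back just once:
  -- R = pre ++ mid ++ suf, pre a prefix and suf a suffix of P, mid avoids P;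
  -- the divergence point (last vertex of pre) is at index i on P.
  DivOnce : List (Fin n) → List (Fin n) → ℕ → Set
  DivOnce P R i =
    Σ (List (Fin n)) λ pre → Σ (List (Fin n)) λ mid → Σ (List (Fin n)) λ suf →
    Σ (List (Fin n)) λ rest → Σ (List (Fin n)) λ rest' →
      P ≡ pre ++ rest × P ≡ rest' ++ suf × R ≡ pre ++ mid ++ suf
      × pre ≢ [] × suf ≢ [] × All (_∉ P) mid × length pre ≡ suc i

  -- R is the replacement path  s y ⋄ e  (e = tree edge with child c lying
  -- on the tree path P from s to y):
  -- R is a shortest s–y path in G ∖ {e} satisfying (1), with divergence
  -- point as close to s as possible (2), and lexicographically smallest (3).
  IsRepl : Fin n → Fin n → List (Fin n) → List (Fin n) → Set
  IsRepl c y P R =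
    Path (AdjMinus c) s y R × IsDist (AdjMinus c) s y (len R) ×
    (∃ λ i → DivOnce P R i
       × (∀ R' i' → Path (AdjMinus c) s y R' → len R' ≡ len R → DivOnce P R' i' → i ≤ i')
       × (∀ R' → Path (AdjMinus c) s y R' → len R' ≡ len R → DivOnce P R' i → LexLeq R R'))

  -- R is jumping w.r.t. e (child c) on the s–r tree path Psr:
  -- R uses a vertex of Psr lying after e (i.e. c or a descendant of c)
  Jumping : List (Fin n) → Fin n → List (Fin n) → Set
  Jumping Psr c R = ∃ λ v → v ∈ R × v ∈ Psr × Anc c v

  UsesEdgeIn : (Fin n → Set) → List (Fin n) → Set
  UsesEdgeIn VS R =
    Σ (List (Fin n)) λ pre → Σ (List (Fin n)) λ suf → ∃₂ λ a b →
      R ≡ pre ++ a ∷ b ∷ suf × VS a × VS b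

{-# OPTIONS --safe #-}
-- Let w be a vertex of R on the s–r tree path below e, and a a vertex of R in N, so r lies on the
-- tree path between w and a. Depths in the BFS tree are 1-Lipschitz along edges, so the part of R
-- between a and w is at least as long as the tree path from a up through r to w, and that tree
-- path avoids e. Swapping it in gives an s–t walk in G ∖ e through r that is no longer than R, so
-- |R| = |sr ⋄ e| + |r t|_{G ∖ e}. Finally r and t both lie below e, and a walk between them that
-- uses e passes through the lower endpoint of e, which costs at least the tree detour avoiding e;
-- hence the distance from r to t is the same in G and in G ∖ e.
module Submission where

open import Defs
open import Data.Nat using (ℕ; suc; _+_; _≤_; _<_; s≤s)
open import Data.Nat.Properties hiding (_≟_)
open import Data.Fin using (Fin; _≟_)
open import Data.Bool using (T)
open import Data.List using (List; []; _∷_; length)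
open import Data.List.Membership.Propositional using (_∈_)
open import Data.List.Membership.Propositional.Properties using (∈-++⁻; ∈-++⁺ʳ)
import Data.List.Membership.DecPropositional as DecMembership
open import Data.List.Relation.Unary.Any using (here; there)
import Data.List.Relation.Unary.All as All
open import Data.List.Relation.Unary.All.Properties.Core using (¬Any⇒All¬)
open import Data.List.Relation.Unary.AllPairs using ([]; _∷_)
open import Data.List.Relation.Unary.Unique.Propositional using (Unique)
open import Data.Product using (∃; ∃₂; _×_; _,_; proj₁; proj₂)
open import Data.Sum using (_⊎_; inj₁; inj₂)
open import Function using (id)
open import Relation.Binary.Definitions using (Symmetric)
open import Relation.Nullary using (¬_; yes; no)
open import Relation.Binary.PropositionalEquality
  using (_≡_; _≢_; refl; sym; trans; cong; subst)

infixr 5 _◅_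

data Walk# {n : ℕ} (A : Fin n → Fin n → Set) : Fin n → Fin n → ℕ → Set where
  ε   : ∀ {x} → Walk# A x x 0
  _◅_ : ∀ {x y z k} → A x y → Walk# A y z k → Walk# A x z (suc k)

map : ∀ {n} {A B : Fin n → Fin n → Set} → (∀ {u v} → A u v → B u v) →
      ∀ {x y k} → Walk# A x y k → Walk# B x y k
map f ε       = ε
map f (e ◅ w) = f e ◅ map f w

+-rearrange-≤ : ∀ k a b l m → a + b ≤ l → (k + a) + (b + m) ≤ k + l + m
+-rearrange-≤ k a b l m a+b≤l = begin
  (k + a) + (b + m) ≡⟨ +-assoc k a (b + m) ⟩
  k + (a + (b + m)) ≡⟨ cong (k +_) (sym (+-assoc a b m)) ⟩
  k + (a + b + m)   ≡⟨ sym (+-assoc k (a + b) m) ⟩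
  k + (a + b) + m   ≤⟨ +-monoˡ-≤ m (+-monoʳ-≤ k a+b≤l) ⟩
  k + l + m         ∎
  where open ≤-Reasoning

module _ {n : ℕ} {A : Fin n → Fin n → Set} where

  infixr 5 _◅◅_
  infixl 5 _▻_

  _◅◅_ : ∀ {x y z k l} → Walk# A x y k → Walk# A y z l → Walk# A x z (k + l)
  ε       ◅◅ v = v
  (e ◅ w) ◅◅ v = e ◅ (w ◅◅ v)

  _▻_ : ∀ {x y z k} → Walk# A x y k → A y z → Walk# A x z (suc k)
  ε       ▻ e = e ◅ ε
  (d ◅ w) ▻ e = d ◅ (w ▻ e)

  reverse : Symmetric A → ∀ {x y k} → Walk# A x y k → Walk# A y x k
  reverse sym-A ε       = ε
  reverse sym-A (e ◅ w) = reverse sym-A w ▻ sym-A e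


  length≡suc-len : ∀ {x y p} → Walk A x y p → length p ≡ suc (len p)
  length≡suc-len [ _ ]ʷ   = refl
  length≡suc-len (_ ∷ʷ _) = refl

  walk-head : ∀ {x y v p} → Walk A x y (v ∷ p) → v ≡ x
  walk-head [ _ ]ʷ   = refl
  walk-head (_ ∷ʷ _) = refl

  toWalk# : ∀ {x y p} → Walk A x y p → Walk# A x y (len p)
  toWalk# [ _ ]ʷ             = ε
  toWalk# (e ∷ʷ w@([ _ ]ʷ))  = e ◅ toWalk# w
  toWalk# (e ∷ʷ w@(_ ∷ʷ _))  = e ◅ toWalk# w

  fromWalk# : ∀ {x y k} → Walk# A x y k → ∃ λ p → Walk A x y p × len p ≡ k
  fromWalk# {x} ε = x ∷ [] , [ x ]ʷ , refl
  fromWalk# (e ◅ w) with fromWalk# w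
  ... | p , wp , refl = _ , e ∷ʷ wp , length≡suc-len wp

  private
    open DecMembership (_≟_ {n}) using (_∈?_)

    suffix : ∀ {x y v p} → Walk A x y p → v ∈ p →
             ∃ λ q → Walk A v y q × (Unique p → Unique q) × length q ≤ length p
    suffix w (here refl) with refl ← walk-head w = _ , w , id , ≤-refl
    suffix [ _ ]ʷ   (there ())
    suffix (_ ∷ʷ w) (there v∈p) with suffix w v∈p
    ... | q , wq , unique , q≤p =
      q , wq , (λ { (_ ∷ u) → unique u }) , m≤n⇒m≤1+n q≤p

    shortcut : ∀ {x y p} → Walk A x y p → ∃ λ q → Path A x y q × length q ≤ length p
    shortcut [ x ]ʷ = _ , ([ x ]ʷ , All.[] ∷ []) , ≤-refl
    shortcut {x} (e ∷ʷ w) with shortcut w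
    ... | q , (wq , uq) , q≤p with x ∈? q
    ...   | no x∉q = x ∷ q , (e ∷ʷ wq , ¬Any⇒All¬ q x∉q ∷ uq) , s≤s q≤p
    ...   | yes x∈q with suffix wq x∈q
    ...     | q' , wq' , unique , q'≤q = q' , (wq' , unique uq) , m≤n⇒m≤1+n (≤-trans q'≤q q≤p)

  walk#⇒path : ∀ {x y k} → Walk# A x y k → ∃ λ q → Path A x y q × len q ≤ k
  walk#⇒path w with fromWalk# w
  ... | p , wp , refl with shortcut wp
  ...   | q , pq , q≤p = q , pq , ∸-monoˡ-≤ 1 q≤p


  dist≤length : ∀ {x y d k} → IsDist A x y d → Walk# A x y k → d ≤ k
  dist≤length (_ , d≤) w with walk#⇒path w
  ... | q , pq , q≤k = ≤-trans (d≤ q pq) q≤k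

  shortest⇒IsDist : ∀ {x y k} → Walk# A x y k → (∀ {l} → Walk# A x y l → k ≤ l) →
                    IsDist A x y k
  shortest⇒IsDist w k≤ with walk#⇒path w
  ... | q , pq , q≤k = (q , pq , ≤-antisym q≤k (k≤ (toWalk# (proj₁ pq)))) ,
                       λ p pp → k≤ (toWalk# (proj₁ pp))

  shortest-concat : ∀ {x y z X Y} → Walk# A x y X → Walk# A y z Y →
                    (∀ {k} → Walk# A x z k → X + Y ≤ k) →
                    IsDist A x y X × (∀ {k} → Walk# A y z k → Y ≤ k)
  shortest-concat {X = X} {Y} wx wy X+Y≤ =
    shortest⇒IsDist wx (λ {k} w → +-cancelʳ-≤ Y X k (X+Y≤ (w ◅◅ wy))) ,
    λ {k} w → +-cancelˡ-≤ X Y k (X+Y≤ (wx ◅◅ w))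


  record Via (x v y : Fin n) (L : ℕ) : Set where
    constructor via
    field
      {k l}   : ℕ
      to      : Walk# A x v k
      from    : Walk# A v y l
      length≡ : L ≡ k + l

  record Via₂ (x u v y : Fin n) (L : ℕ) : Set where
    constructor via₂
    field
      {k l m} : ℕ
      before  : Walk# A x u k
      between : Walk# A u v l
      after   : Walk# A v y m
      length≡ : L ≡ k + l + m

  split-∈ : ∀ {x y v p} → Walk A x y p → v ∈ p → Via x v y (len p)
  split-∈ w (here refl) with refl ← walk-head w = via ε (toWalk# w) refl
  split-∈ [ _ ]ʷ (there ())
  split-∈ (e ∷ʷ w) (there v∈p) with split-∈ w v∈p
  ... | via to from eq = via (e ◅ to) from (trans (length≡suc-len w) (cong suc eq))

  split-∈₂ : ∀ {x y u v p} → Walk A x y p → u ∈ p → v ∈ p →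
             Via₂ x u v y (len p) ⊎ Via₂ x v u y (len p)
  split-∈₂ w (here refl) v∈p with refl ← walk-head w | split-∈ w v∈p
  ... | via to from eq = inj₁ (via₂ ε to from eq)
  split-∈₂ w (there u∈p) (here refl) with refl ← walk-head w | split-∈ w (there u∈p)
  ... | via to from eq = inj₂ (via₂ ε to from eq)
  split-∈₂ [ _ ]ʷ (there ()) (there _)
  split-∈₂ (e ∷ʷ w) (there u∈p) (there v∈p) with split-∈₂ w u∈p v∈p
  ... | inj₁ (via₂ b m a eq) = inj₁ (via₂ (e ◅ b) m a (trans (length≡suc-len w) (cong suc eq)))
  ... | inj₂ (via₂ b m a eq) = inj₂ (via₂ (e ◅ b) m a (trans (length≡suc-len w) (cong suc eq)))

  reroute : Symmetric A → ∀ {x y z u v h h' p} → Walk A x z p → u ∈ p → v ∈ p →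
            Walk# A y v h → Walk# A u y h' → (∀ {l} → Walk# A v u l → h' + h ≤ l) →
            ∃₂ λ X Y → Walk# A x y X × Walk# A y z Y × X + Y ≤ len p
  reroute sym-A {h = h} {h'} w u∈p v∈p y→v u→y detour≤ with split-∈₂ w u∈p v∈p
  ... | inj₁ (via₂ {k} {l} {m} x→u u→v v→z p≡) =
    k + h' , h + m , x→u ◅◅ u→y , y→v ◅◅ v→z ,
    subst (k + h' + (h + m) ≤_) (sym p≡) (+-rearrange-≤ k h' h l m (detour≤ (reverse sym-A u→v)))
  ... | inj₂ (via₂ {k} {l} {m} x→v v→u u→z p≡) =
    k + h , h' + m , x→v ◅◅ reverse sym-A y→v , reverse sym-A u→y ◅◅ u→z ,
    subst (k + h + (h' + m) ≤_) (sym p≡) (+-rearrange-≤ k h h' l m (subst (_≤ l) (+-comm h' h) (detour≤ v→u)))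

module AvoidingTreeEdge {n : ℕ} (G : Graph n) (s : Fin n) (Tr : SPT G s)
                        (c : Fin n) (c≢s : c ≢ s) where
  open SPT Tr renaming (depth to D)

  Adj : Fin n → Fin n → Set
  Adj = Graph.Adj G

  G∖e : Fin n → Fin n → Set
  G∖e = AdjMinus Tr c

  sym-Adj : Symmetric Adj
  sym-Adj {u} {v} = subst T (Graph.sym G u v)

  sym-G∖e : Symmetric G∖e
  sym-G∖e (uv , uv≢e) = sym-Adj uv , λ
    { (inj₁ (v≡pc , u≡c)) → uv≢e (inj₂ (u≡c , v≡pc))
    ; (inj₂ (v≡c , u≡pc)) → uv≢e (inj₁ (u≡pc , v≡c)) }

  depth-edge : ∀ {u v} → Adj u v → D v ≤ suc (D u)
  depth-edge {u} uv with proj₁ (depth-dst u)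
  ... | p , pp , p≡u = subst (λ d → D _ ≤ suc d) p≡u
                          (dist≤length (depth-dst _) (toWalk# (proj₁ pp) ▻ uv))

  depth-rise : ∀ {u v l} → Walk# Adj u v l → D v ≤ l + D u
  depth-rise ε = ≤-refl
  depth-rise {u} {v} (_◅_ {k = l} uy w) = begin
    D v             ≤⟨ depth-rise w ⟩
    l + D _         ≤⟨ +-monoʳ-≤ l (depth-edge uy) ⟩
    l + suc (D u)   ≡⟨ +-suc l (D u) ⟩
    suc l + D u     ∎
    where open ≤-Reasoning


  record Ascent (v x : Fin n) : Set where
    field
      {height} : ℕ
      depth≡   : D v ≡ height + D x
      walk     : Walk# G∖e v x height

  open Ascent

  ascent-refl : ∀ {x} → Ascent x x
  ascent-refl = record { depth≡ = refl ; walk = ε }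

  ascent-trans : ∀ {u v x} → Ascent u v → Ascent v x → Ascent u x
  ascent-trans uv vx = record
    { depth≡ = trans (depth≡ uv) (trans (cong (height uv +_) (depth≡ vx))
                                        (sym (+-assoc (height uv) (height vx) _)))
    ; walk   = walk uv ◅◅ walk vx }

  ascent-depth-≤ : ∀ {v x} → Ascent v x → D x ≤ D v
  ascent-depth-≤ vx = subst (D _ ≤_) (sym (depth≡ vx)) (m≤n+m _ (height vx))

  parent-ascent : ∀ {v} → v ≢ s → D c < D v → Ascent v (parent v)
  parent-ascent {v} v≢s c<v = record
    { depth≡ = depth-par v v≢s
    ; walk   = (sym-Adj (par-adj v v≢s) , v-pv≢e) ◅ ε }
    where
    v-pv≢e : ¬ SameEdge Tr c v (parent v)
    v-pv≢e (inj₁ (v≡pc , _)) = <-asym c<v (subst (λ x → D x < D c) (sym v≡pc) pc<c)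
      where
      pc<c : D (parent c) < D c
      pc<c = subst (D (parent c) <_) (sym (depth-par c c≢s)) (n<1+n _)
    v-pv≢e (inj₂ (v≡c , _)) = <-irrefl (cong D (sym v≡c)) c<v

  ascent : ∀ {v x p} → TreePath Tr v p → x ∈ p → D c ≤ D x → Ascent v x
  ascent root (here refl) _ = ascent-refl
  ascent root (there ())
  ascent (step {v} {p} v≢s tp) x∈p c≤x with ∈-++⁻ p x∈p
  ... | inj₂ (here refl) = ascent-refl
  ... | inj₂ (there ())
  ... | inj₁ x∈p' = ascent-trans (parent-ascent v≢s c<v) pv↑x
    where
    pv↑x = ascent tp x∈p' c≤x
    c<v : D c < D v
    c<v = subst (D c <_) (sym (depth-par v v≢s))
                (s≤s (≤-trans c≤x (ascent-depth-≤ pv↑x)))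

  ascent-shortest : ∀ {v x l} → (vx : Ascent v x) → Walk# Adj x v l → height vx ≤ l
  ascent-shortest {x = x} {l} vx w =
    +-cancelʳ-≤ (D x) (height vx) l (subst (_≤ l + D x) (depth≡ vx) (depth-rise w))


  -- Both endpoints of e are c or adjacent to c, so a walk using e passes through c.
  avoid-or-via-c : ∀ {u v z} → Walk# Adj u v z → Walk# G∖e u v z ⊎ Via {A = Adj} u c v z
  avoid-or-via-c ε = inj₁ ε
  avoid-or-via-c {u} (_◅_ {y = y} uy w) with u ≟ c | y ≟ c
  ... | yes refl | _        = inj₂ (via ε (uy ◅ w) refl)
  ... | no _     | yes refl = inj₂ (via (uy ◅ ε) w refl)
  ... | no u≢c   | no y≢c with avoid-or-via-c w
  ...   | inj₁ w'               = inj₁ ((uy , uy≢e) ◅ w')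
    where
    uy≢e : ¬ SameEdge Tr c u y
    uy≢e (inj₁ (_ , y≡c)) = y≢c y≡c
    uy≢e (inj₂ (u≡c , _)) = u≢c u≡c
  ...   | inj₂ (via to from eq) = inj₂ (via (uy ◅ to) from (cong suc eq))

  shortest∖e⇒IsDist : ∀ {r t Y} → Ascent r c → Ascent t c → Walk# G∖e r t Y →
                      (∀ {k} → Walk# G∖e r t k → Y ≤ k) → IsDist Adj r t Y
  shortest∖e⇒IsDist r↑c t↑c w Y≤ = shortest⇒IsDist (map proj₁ w) Y≤'
    where
    Y≤' : ∀ {k} → Walk# Adj _ _ k → _ ≤ k
    Y≤' w' with avoid-or-via-c w'
    ... | inj₁ w∖e = Y≤ w∖e
    ... | inj₂ (via to from refl) =
      ≤-trans (Y≤ (walk r↑c ◅◅ reverse sym-G∖e (walk t↑c)))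
              (+-mono-≤ (ascent-shortest r↑c (reverse sym-Adj to)) (ascent-shortest t↑c from))

lemma7 : ∀ {n} (G : Graph n) (s : Fin n) (Tr : SPT G s) (S : Split Tr)
           (c t : Fin n) (Psr Pst R : List (Fin n)) →
           TreePath Tr (Split.r S) Psr →
           TreePath Tr t Pst →
           c ≢ s → c ∈ Psr → c ∈ Pst →
           Subtree.VS (Split.M S) t →
           IsRepl Tr c t Pst R →
           Jumping Tr Psr c R →
           UsesEdgeIn Tr (Subtree.VS (Split.N S)) R →
           ∃₂ λ d₁ d₂ → IsDist (AdjMinus Tr c) s (Split.r S) d₁
                       × IsDist (Graph.Adj G) (Split.r S) t d₂
                       × len R ≡ d₁ + d₂
lemma7 G s Tr S c t Psr Pst R r-path t-path c≢s c∈Psr c∈Pst _ ((R-walk , _) , R-shortest , _)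
       (w , w∈R , w∈Psr , _ , w-path , c∈pw) (pre , _ , a , _ , R≡ , a∈N , _) =
  conclude (reroute {A = G∖e} sym-G∖e R-walk a∈R w∈R (walk r↑w) (walk a↑r)
                    (λ w→a → ascent-shortest (ascent-trans a↑r r↑w) (map proj₁ w→a)))
  where
  open AvoidingTreeEdge G s Tr c c≢s
  open Ascent
  r = Split.r S
  a-ancestry = Split.N-rooted S a a∈N
  a∈R = subst (a ∈_) (sym R≡) (∈-++⁺ʳ pre (here refl))
  r↑c = ascent r-path c∈Psr ≤-refl
  t↑c = ascent t-path c∈Pst ≤-refl
  r↑w = ascent r-path w∈Psr (ascent-depth-≤ (ascent w-path c∈pw ≤-refl))
  a↑r = ascent (proj₁ (proj₂ a-ancestry)) (proj₂ (proj₂ a-ancestry)) (ascent-depth-≤ r↑c)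

  R≤ : ∀ {k} → Walk# G∖e s t k → len R ≤ k
  R≤ = dist≤length R-shortest

  conclude : (∃₂ λ X Y → Walk# G∖e s r X × Walk# G∖e r t Y × X + Y ≤ len R) →
             ∃₂ λ X Y → IsDist G∖e s r X × IsDist Adj r t Y × len R ≡ X + Y
  conclude (X , Y , s→r , r→t , X+Y≤R) =
    X , Y , proj₁ optimal , shortest∖e⇒IsDist r↑c t↑c r→t (proj₂ optimal) , R≡X+Y
    where
    R≡X+Y = ≤-antisym (R≤ (s→r ◅◅ r→t)) X+Y≤R
    optimal = shortest-concat s→r r→t (λ {k} w → subst (_≤ k) R≡X+Y (R≤ w))
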